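{- Let $A$ be a matrix with rational entries having $m$ rows and $n$ columns, and let $b\in\mathbb{Q}^{m'}$, $c\in\mathbb{Q}^{n'}$ be rational vectors. Suppose $\mathtt{maximize}\ A\ b\ c = \mathtt{Some}\ (\mathtt{Sat}\ (x,y))$, where $\mathtt{maximize}$ is the procedure described in the context. Then $x\in\mathtt{max\_lp}\ A\ b\ c$; that is, $x\in\mathbb{Q}^n$, $Ax\le b$ componentwise, and for every $x'\in\mathbb{Q}^n$ with $Ax'\le b$ componentwise we have $c\cdot x'\le c\cdot x$.
   Context: Linear constraints are over variables $v_0,v_1,v_2,\dots$ indexed by natural numbers; a constraint has the form $p\le q$, $p\ge q$ or $p=q$ for linear polynomials $p,q$ with rational coefficients in finitely many variables. The procedure $\mathtt{simplex}$ takes a finite list of such constraints and returns either $\mathtt{Unsat}\ S$ (with $S$ a list of constraint indices) or $\mathtt{Sat}\ \rho$, where $\rho:\mathbb{N}\to\mathbb{Q}$ is an assignment satisfying every constraint in the list (soundness of simplex). The procedure $\mathtt{maximize}\ A\ b\ c$: if $\dim b$ equals the number of rows of $A$ and $\dim c$ equals the number of columns of $A$, it returns $\mathtt{Some}(R)$, otherwise $\mathtt{None}$, where $R$ is computed as follows. Put $n=\dim c$, $m=\dim b$. Form the constraint list consisting of: (i) $\sum_{k<n} c_k v_k \ge \sum_{j<m} b_j v_{n+j}$; (ii) for each $i<m$: $\sum_{k<n} A_{ik} v_k \le b_i$; (iii) for each $k<n$: $\sum_{i<m} A_{ik} v_{n+i} = c_k$; (iv) for each $j<m$: $v_{n+j}\ge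 0$. Run $\mathtt{simplex}$ on this list; if it returns $\mathtt{Unsat}\ S$, then $R=\mathtt{Unsat}\ S$; if it returns $\mathtt{Sat}\ \rho$, then $R=\mathtt{Sat}\ (x,y)$ with $x=(\rho(0),\dots,\rho(n-1))\in\mathbb{Q}^n$ and $y=(\rho(n),\dots,\rho(n+m-1))\in\mathbb{Q}^m$. The set $\mathtt{max\_lp}\ A\ b\ c$ is the set of vectors $x$ with $Ax\le b$ (componentwise) such that $c\cdot x'\le c\cdot x$ for all $x'$ with $Ax'\le b$. -}

module Defs where

open import Data.Nat using (ℕ; _+_) renaming (_≟_ to _≟ℕ_)
open import Data.Fin using (Fin; toℕ)
open import Data.Rational using (ℚ; 0ℚ; _≤_) renaming (_+_ to _+ℚ_; _*_ to _*ℚ_)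
open import Data.List using (List; []; _∷_; _++_; map; foldr; allFin; zip)
open import Data.List.Relation.Unary.All using (All)
open import Data.Vec using (Vec; lookup; toList; tabulate)
open import Data.Maybe using (Maybe; just; nothing)
open import Data.Product using (_×_; _,_)
open import Relation.Binary.PropositionalEquality using (_≡_; refl)
open import Relation.Nullary using (yes; no)

record LinPoly : Set where
  constructor linpoly
  field
    constTerm : ℚ
    terms     : List (ℕ × ℚ)

sumℚ : List ℚ → ℚ
sumℚ = foldr _+ℚ_ 0ℚ

evalPoly : (ℕ → ℚ) → LinPoly → ℚ
evalPoly ρ (linpoly k ts) = k +ℚ sumℚ (map (λ { (v , a) → a *ℚ ρ v }) ts)

constPoly : ℚ → LinPoly
constPoly k = linpoly k []

termsPoly : List (ℕ × ℚ) → LinPoly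
termsPoly ts = linpoly 0ℚ ts

data Constraint : Set where
  leqC : LinPoly → LinPoly → Constraint
  geqC : LinPoly → LinPoly → Constraint
  eqC  : LinPoly → LinPoly → Constraint

Satisfies : (ℕ → ℚ) → Constraint → Set
Satisfies ρ (leqC p q) = evalPoly ρ p ≤ evalPoly ρ q
Satisfies ρ (geqC p q) = evalPoly ρ q ≤ evalPoly ρ p
Satisfies ρ (eqC p q)  = evalPoly ρ p ≡ evalPoly ρ q

data SimplexResult : Set where
  Unsat : List ℕ → SimplexResult
  Sat   : (ℕ → ℚ) → SimplexResult

SimplexSound : (List Constraint → SimplexResult) → Set
SimplexSound simplex =
  ∀ (cs : List Constraint) (ρ : ℕ → ℚ) → simplex cs ≡ Sat ρ → All (Satisfies ρ) cs

Matrix : ℕ → ℕ → Set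
Matrix m n = Vec (Vec ℚ n) m

data LPResult (n m : ℕ) : Set where
  Unsat : List ℕ → LPResult n m
  Sat   : Vec ℚ n × Vec ℚ m → LPResult n m

lpConstraints : ∀ {m n} → Matrix m n → Vec ℚ m → Vec ℚ n → List Constraint
lpConstraints {m} {n} A b c =
    geqC (termsPoly (map (λ k → (toℕ k , lookup c k)) (allFin n)))
         (termsPoly (map (λ j → (n + toℕ j , lookup b j)) (allFin m)))
  ∷ (map (λ i → leqC (termsPoly (map (λ k → (toℕ k , lookup (lookup A i) k)) (allFin n)))
                     (constPoly (lookup b i)))
         (allFin m)
  ++ (map (λ k → eqC (termsPoly (map (λ i → (n + toℕ i , lookup (lookup A i) k)) (allFin m)))
                     (constPoly (lookup c k)))
          (allFin n)
  ++  map (λ j → geqC (termsPoly ((n + toℕ j , Data.Rational.1ℚ) ∷ []))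
                      (constPoly 0ℚ))
          (allFin m)))

maximize' : (List Constraint → SimplexResult) →
            ∀ {m n} → Matrix m n → Vec ℚ m → Vec ℚ n → LPResult n m
maximize' simplex {m} {n} A b c with simplex (lpConstraints A b c)
... | Unsat S = Unsat S
... | Sat ρ   = Sat (tabulate (λ k → ρ (toℕ k)) , tabulate (λ j → ρ (n + toℕ j)))

maximize : (List Constraint → SimplexResult) →
           ∀ {m n m' n'} → Matrix m n → Vec ℚ m' → Vec ℚ n' → Maybe (LPResult n m)
maximize simplex {m} {n} {m'} {n'} A b c with m' ≟ℕ m | n' ≟ℕ n
... | yes refl | yes refl = just (maximize' simplex A b c)
... | _        | _        = nothing

_·_ : ∀ {n} → Vec ℚ n → Vec ℚ n → ℚ
_·_ {n} u v = sumℚ (map (λ k → lookup u k *ℚ lookup v k) (allFin n))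

_*ᵥ_ : ∀ {m n} → Matrix m n → Vec ℚ n → Vec ℚ m
A *ᵥ x = tabulate (λ i → lookup A i · x)

_≤ᵥ_ : ∀ {m} → Vec ℚ m → Vec ℚ m → Set
u ≤ᵥ v = ∀ i → lookup u i ≤ lookup v i

MaxLP : ∀ {m n} → Matrix m n → Vec ℚ m → Vec ℚ n → Vec ℚ n → Set
MaxLP {m} {n} A b c x =
  (A *ᵥ x) ≤ᵥ b × (∀ (x' : Vec ℚ n) → (A *ᵥ x') ≤ᵥ b → (c · x') ≤ (c · x))

-- The constraints handed to simplex say exactly that x is primal feasible
-- (Ax ≤ b), y is dual feasible (Aᵀy = c, y ≥ 0) and b·y ≤ c·x.  Weak duality
-- then bounds every primal-feasible x':  c·x' = yᵀAx' ≤ y·b ≤ c·x.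

module Submission where

open import Defs
open import Data.Nat using (ℕ; zero; suc) renaming (_+_ to _+ℕ_; _≟_ to _≟ℕ_)
open import Data.Rational using (ℚ; 0ℚ; 1ℚ; _≤_; _+_; _*_; nonNegative)
open import Data.Rational.Properties
  using (+-*-ring; +-identityˡ; +-identityʳ; *-identityˡ; *-comm; *-assoc;
         ≤-refl; ≤-reflexive; ≤-trans; +-mono-≤; *-monoˡ-≤-nonNeg; module ≤-Reasoning)
open import Algebra.Bundles using (Ring)
open import Algebra.Properties.Semiring.Sum (Ring.semiring +-*-ring)
  using (sum; sum-syntax; sum-cong-≗; ∑-comm; *-distribˡ-sum; *-distribʳ-sum)
open import Data.Fin using (Fin; toℕ) renaming (zero to fzero; suc to fsuc)
open import Data.List using (List; []; _∷_; map; allFin) renaming (tabulate to tabulateᴸ)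
open import Data.List.Properties using (map-∘; map-tabulate)
open import Data.List.Relation.Unary.All using (All) renaming (_∷_ to _∷ᴬ_)
open import Data.List.Relation.Unary.All.Properties using (map⁻; ++⁻; tabulate⁻)
open import Data.Vec using (Vec; lookup; tabulate)
open import Data.Vec.Properties using (lookup∘tabulate)
open import Data.Maybe using (just)
open import Data.Maybe.Properties using (just-injective)
open import Data.Product using (Σ; _,_; proj₁; proj₂)
open import Function using (_∘_; id)
open import Relation.Binary.PropositionalEquality
open import Relation.Nullary using (yes; no)

sumℚ-tabulate : ∀ {n} (f : Fin n → ℚ) → sumℚ (tabulateᴸ f) ≡ sum f
sumℚ-tabulate {zero}  f = refl
sumℚ-tabulate {suc n} f = cong (f fzero +_) (sumℚ-tabulate (f ∘ fsuc))

sumℚ-map-allFin : ∀ n (f : Fin n → ℚ) → sumℚ (map f (allFin n)) ≡ sum f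
sumℚ-map-allFin n f = trans (cong sumℚ (map-tabulate id f)) (sumℚ-tabulate f)

sum-mono-≤ : ∀ {n} {f g : Fin n → ℚ} → (∀ k → f k ≤ g k) → sum f ≤ sum g
sum-mono-≤ {zero}  f≤g = ≤-refl
sum-mono-≤ {suc n} f≤g = +-mono-≤ (f≤g fzero) (sum-mono-≤ (f≤g ∘ fsuc))

·-sum : ∀ {n} (u v : Vec ℚ n) → u · v ≡ ∑[ k < n ] (lookup u k * lookup v k)
·-sum {n} u v = sumℚ-map-allFin n _

*ᵥ-sum : ∀ {m n} (A : Matrix m n) (v : Vec ℚ n) (i : Fin m) →
         lookup (A *ᵥ v) i ≡ ∑[ k < n ] (lookup (lookup A i) k * lookup v k)
*ᵥ-sum A v i = trans (lookup∘tabulate _ i) (·-sum (lookup A i) v)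

evalPoly-termsPoly : ∀ {n} (ρ : ℕ → ℚ) (var : Fin n → ℕ) (coeff : Fin n → ℚ) →
  evalPoly ρ (termsPoly (map (λ k → (var k , coeff k)) (allFin n)))
    ≡ ∑[ k < n ] (coeff k * ρ (var k))
evalPoly-termsPoly {n} ρ var coeff =
  trans (+-identityˡ _) (trans (cong sumℚ (sym (map-∘ (allFin n)))) (sumℚ-map-allFin n _))

record OptimalityCertificate {m n : ℕ} (A : Fin m → Fin n → ℚ) (b : Fin m → ℚ)
                             (c : Fin n → ℚ) (x : Fin n → ℚ) (y : Fin m → ℚ) : Set where
  field
    primal-feasible : ∀ i → ∑[ k < n ] (A i k * x k) ≤ b i
    dual-feasible   : ∀ k → ∑[ i < m ] (A i k * y i) ≡ c k
    dual-nonneg     : ∀ i → 0ℚ ≤ y i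
    objective-gap   : ∑[ i < m ] (b i * y i) ≤ ∑[ k < n ] (c k * x k)

weak-duality : ∀ {m n} (A : Fin m → Fin n → ℚ) (b : Fin m → ℚ) (c : Fin n → ℚ) (y : Fin m → ℚ) →
  (∀ k → ∑[ i < m ] (A i k * y i) ≡ c k) → (∀ i → 0ℚ ≤ y i) →
  (x : Fin n → ℚ) → (∀ i → ∑[ k < n ] (A i k * x k) ≤ b i) →
  ∑[ k < n ] (c k * x k) ≤ ∑[ i < m ] (b i * y i)
weak-duality {m} {n} A b c y Aᵀy≡c y≥0 x Ax≤b = begin
  ∑[ k < n ] (c k * x k)                          ≡⟨ sum-cong-≗ {n} (λ k → cong (_* x k) (sym (Aᵀy≡c k))) ⟩
  ∑[ k < n ] (∑[ i < m ] (A i k * y i) * x k)     ≡⟨ sum-cong-≗ {n} (λ k → *-distribʳ-sum {m} (x k) _) ⟩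
  ∑[ k < n ] ∑[ i < m ] (A i k * y i * x k)       ≡⟨ ∑-comm {n} {m} _ ⟩
  ∑[ i < m ] ∑[ k < n ] (A i k * y i * x k)       ≡⟨ sum-cong-≗ {m} (λ i → sum-cong-≗ {n} (λ k → regroup (A i k) (y i) (x k))) ⟩
  ∑[ i < m ] ∑[ k < n ] (y i * (A i k * x k))     ≡⟨ sum-cong-≗ {m} (λ i → sym (*-distribˡ-sum {n} (y i) _)) ⟩
  ∑[ i < m ] (y i * ∑[ k < n ] (A i k * x k))     ≤⟨ sum-mono-≤ {m} (λ i → *-monoˡ-≤-nonNeg (y i) {{nonNegative (y≥0 i)}} (Ax≤b i)) ⟩
  ∑[ i < m ] (y i * b i)                          ≡⟨ sum-cong-≗ {m} (λ i → *-comm (y i) (b i)) ⟩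
  ∑[ i < m ] (b i * y i)                          ∎
  where
  open ≤-Reasoning
  regroup : ∀ a u v → a * u * v ≡ u * (a * v)
  regroup a u v = trans (cong (_* v) (*-comm a u)) (*-assoc u a v)

certificate⇒MaxLP : ∀ {m n} (A : Matrix m n) (b : Vec ℚ m) (c : Vec ℚ n) (x : Fin n → ℚ) (y : Fin m → ℚ) →
  OptimalityCertificate (lookup ∘ lookup A) (lookup b) (lookup c) x y → MaxLP A b c (tabulate x)
certificate⇒MaxLP {m} {n} A b c x y cert = feasible , maximal
  where
  open OptimalityCertificate cert
  lookup-x : ∀ (u : Vec ℚ n) → ∑[ k < n ] (lookup u k * lookup (tabulate x) k) ≡ ∑[ k < n ] (lookup u k * x k)
  lookup-x u = sum-cong-≗ {n} (λ k → cong (lookup u k *_) (lookup∘tabulate x k))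
  feasible : (A *ᵥ tabulate x) ≤ᵥ b
  feasible i = ≤-trans (≤-reflexive (trans (*ᵥ-sum A (tabulate x) i) (lookup-x (lookup A i)))) (primal-feasible i)
  maximal : ∀ x' → (A *ᵥ x') ≤ᵥ b → c · x' ≤ c · tabulate x
  maximal x' Ax'≤b = begin
    c · x'                                  ≡⟨ ·-sum c x' ⟩
    ∑[ k < n ] (lookup c k * lookup x' k)   ≤⟨ weak-duality (lookup ∘ lookup A) (lookup b) (lookup c) y dual-feasible dual-nonneg (lookup x')
                                                 (λ i → ≤-trans (≤-reflexive (sym (*ᵥ-sum A x' i))) (Ax'≤b i)) ⟩
    ∑[ i < m ] (lookup b i * y i)           ≤⟨ objective-gap ⟩
    ∑[ k < n ] (lookup c k * x k)           ≡⟨ sym (trans (·-sum c (tabulate x)) (lookup-x c)) ⟩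
    c · tabulate x                          ∎
    where open ≤-Reasoning

satisfies-lpConstraints⇒certificate : ∀ {m n} (A : Matrix m n) (b : Vec ℚ m) (c : Vec ℚ n) (ρ : ℕ → ℚ) →
  All (Satisfies ρ) (lpConstraints A b c) →
  OptimalityCertificate (lookup ∘ lookup A) (lookup b) (lookup c) (ρ ∘ toℕ) (λ j → ρ (n +ℕ toℕ j))
satisfies-lpConstraints⇒certificate {m} {n} A b c ρ (gap ∷ᴬ rest) = record
  { primal-feasible = λ i → subst₂ _≤_ (evalPoly-termsPoly ρ toℕ (lookup (lookup A i))) (+-identityʳ _)
                                  (primal i)
  ; dual-feasible   = λ k → trans (sym (evalPoly-termsPoly ρ dualVar (λ i → lookup (lookup A i) k)))
                                  (trans (dual k) (+-identityʳ _))
  ; dual-nonneg     = λ j → subst₂ _≤_ (+-identityʳ 0ℚ)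
                                  (trans (+-identityˡ _) (trans (+-identityʳ _) (*-identityˡ _)))
                                  (nonneg j)
  ; objective-gap   = subst₂ _≤_ (evalPoly-termsPoly ρ dualVar (lookup b))
                                 (evalPoly-termsPoly ρ toℕ (lookup c)) gap
  }
  where
  dualVar : Fin m → ℕ
  dualVar j = n +ℕ toℕ j
  primal : ∀ i → Satisfies ρ (leqC (termsPoly (map (λ k → (toℕ k , lookup (lookup A i) k)) (allFin n)))
                                   (constPoly (lookup b i)))
  primal = tabulate⁻ (map⁻ (proj₁ (++⁻ (map _ (allFin m)) rest)))
  dual : ∀ k → Satisfies ρ (eqC (termsPoly (map (λ i → (dualVar i , lookup (lookup A i) k)) (allFin m)))
                                (constPoly (lookup c k)))
  dual = tabulate⁻ (map⁻ (proj₁ (++⁻ (map _ (allFin n)) (proj₂ (++⁻ (map _ (allFin m)) rest)))))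
  nonneg : ∀ j → Satisfies ρ (geqC (termsPoly ((dualVar j , 1ℚ) ∷ [])) (constPoly 0ℚ))
  nonneg = tabulate⁻ (map⁻ (proj₂ (++⁻ (map _ (allFin n)) (proj₂ (++⁻ (map _ (allFin m)) rest)))))

maximize'-sound : (simplex : List Constraint → SimplexResult) → SimplexSound simplex →
  ∀ {m n} (A : Matrix m n) (b : Vec ℚ m) (c : Vec ℚ n) (x : Vec ℚ n) (y : Vec ℚ m) →
  maximize' simplex A b c ≡ Sat (x , y) → MaxLP A b c x
maximize'-sound simplex sound A b c x y eq with simplex (lpConstraints A b c) in e
maximize'-sound simplex sound A b c _ _ refl | Sat ρ =
  certificate⇒MaxLP A b c _ _ (satisfies-lpConstraints⇒certificate A b c ρ (sound _ ρ e))

mainTheorem1 : (simplex : List Constraint → SimplexResult) → SimplexSound simplex →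
    ∀ {m n m' n' : ℕ} (A : Matrix m n) (b : Vec ℚ m') (c : Vec ℚ n')
      (x : Vec ℚ n) (y : Vec ℚ m) →
    maximize simplex A b c ≡ just (Sat (x , y)) →
    Σ (m' ≡ m) λ p → Σ (n' ≡ n) λ q →
      MaxLP A (subst (Vec ℚ) p b) (subst (Vec ℚ) q c) x
mainTheorem1 simplex sound {m} {n} {m'} {n'} A b c x y eq with m' ≟ℕ m | n' ≟ℕ n
... | yes refl | yes refl = refl , refl , maximize'-sound simplex sound A b c x y (just-injective eq)
... | yes refl | no _     with () ← eq
... | no _     | _        with () ← eq
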